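{- If $G$ is a rationally $K_3$-decomposable multigraph whose underlying simple graph is $K_3$, $K_4$ or $K_4-e$, then $|E(G)|\equiv 0\pmod 3$.
   Context: A multigraph may have multiple edges but no loops; $|E(G)|$ counts edges with multiplicity. A triangle of a multigraph is a set of three edges joining three vertices pairwise. A rational $K_3$-decomposition is an assignment of nonnegative rational weights to the triangles of $G$ such that for every edge $e$, the sum of the weights of the triangles containing $e$ equals $1$; $G$ is rationally $K_3$-decomposable if such an assignment exists. $K_4-e$ denotes $K_4$ with one edge removed. -}

module Defs where

open import Data.Nat as ℕ using (ℕ; zero; suc; _<_; _<ᵇ_)
open import Data.Fin using (Fin; zero; suc; toℕ)
open import Data.Fin.Properties using () renaming (_≟_ to _≟ᶠ_)
open import Data.Bool using (Bool; true; false; if_then_else_; _∧_; _∨_; not; T)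
open import Data.Rational as ℚ using (ℚ; 0ℚ; 1ℚ)
open import Data.Product using (Σ; ∃; _×_; _,_)
open import Relation.Binary.PropositionalEquality using (_≡_)
open import Relation.Nullary using (Dec; yes; no)
open import Relation.Nullary.Decidable using (⌊_⌋)
open import Function.Definitions using (Bijective)
open import Function.Bundles using (_⇔_)
open import Data.Nat.Divisibility using (_∣_)

sumℚ : (n : ℕ) → (Fin n → ℚ) → ℚ
sumℚ zero    f = 0ℚ
sumℚ (suc n) f = f zero ℚ.+ sumℚ n (λ i → f (suc i))

sumℕ : (n : ℕ) → (Fin n → ℕ) → ℕ
sumℕ zero    f = 0
sumℕ (suc n) f = f zero ℕ.+ sumℕ n (λ i → f (suc i))

_<ᵛ_ : ∀ {n} → Fin n → Fin n → Bool
u <ᵛ v = toℕ u <ᵇ toℕ v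

_==ᵛ_ : ∀ {n} → Fin n → Fin n → Bool
u ==ᵛ v = ⌊ u ≟ᶠ v ⌋

-- Multigraphs (loopless, finitely many edges) on vertex set Fin n,
-- given by the number of parallel edges between each pair of vertices.

record MultiGraph (n : ℕ) : Set where
  field
    mult     : Fin n → Fin n → ℕ
    symmetric : ∀ u v → mult u v ≡ mult v u
    loopless : ∀ u → mult u u ≡ 0
open MultiGraph public

-- An edge: a pair u < v together with one of the mult u v parallel edges.
record Edge {n : ℕ} (G : MultiGraph n) : Set where
  constructor edge
  field
    eu ev  : Fin n
    eu<ev  : toℕ eu < toℕ ev
    eidx   : Fin (mult G eu ev)

-- |E(G)|, counted with multiplicity.
numEdges : ∀ {n} → MultiGraph n → ℕ
numEdges {n} G =
  sumℕ n λ u → sumℕ n λ v → if u <ᵛ v then mult G u v else 0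

-- A triangle: three vertices a < b < c and one chosen edge for each pair.
record Triangle {n : ℕ} (G : MultiGraph n) : Set where
  constructor tri
  field
    ta tb tc : Fin n
    ta<tb    : toℕ ta < toℕ tb
    tb<tc    : toℕ tb < toℕ tc
    iab      : Fin (mult G ta tb)
    ibc      : Fin (mult G tb tc)
    iac      : Fin (mult G ta tc)

contains : ∀ {n} {G : MultiGraph n} → Triangle G → Edge G → Bool
contains (tri a b c _ _ i j k) (edge u v _ x) =
     (u ==ᵛ a ∧ v ==ᵛ b ∧ ⌊ toℕ x ℕ.≟ toℕ i ⌋)
  ∨ (u ==ᵛ b ∧ v ==ᵛ c ∧ ⌊ toℕ x ℕ.≟ toℕ j ⌋)
  ∨ (u ==ᵛ a ∧ v ==ᵛ c ∧ ⌊ toℕ x ℕ.≟ toℕ k ⌋)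

sumIf : {P : Set} → Dec P → (P → ℚ) → ℚ
sumIf (yes p) f = f p
sumIf (no _)  f = 0ℚ

sumTriangles : ∀ {n} (G : MultiGraph n) → (Triangle G → ℚ) → ℚ
sumTriangles {n} G w =
  sumℚ n λ a → sumℚ n λ b → sumℚ n λ c →
  sumIf (toℕ a ℕ.<? toℕ b) λ p →
  sumIf (toℕ b ℕ.<? toℕ c) λ q →
  sumℚ (mult G a b) λ i → sumℚ (mult G b c) λ j → sumℚ (mult G a c) λ k →
  w (tri a b c p q i j k)

RationallyK3Decomposable : ∀ {n} → MultiGraph n → Set
RationallyK3Decomposable G =
  Σ (Triangle G → ℚ) λ w →
    (∀ t → 0ℚ ℚ.≤ w t) ×
    (∀ (e : Edge G) →
       sumTriangles G (λ t → if contains t e then w t else 0ℚ) ≡ 1ℚ)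

SimpleAdj : ℕ → Set
SimpleAdj k = Fin k → Fin k → Bool

K3 : SimpleAdj 3
K3 u v = not (u ==ᵛ v)

K4 : SimpleAdj 4
K4 u v = not (u ==ᵛ v)

K4-e : SimpleAdj 4
K4-e u v = not (u ==ᵛ v)
         ∧ not ((u ==ᵛ zero ∧ v ==ᵛ suc zero) ∨ (u ==ᵛ suc zero ∧ v ==ᵛ zero))

UnderlyingIso : ∀ {n k} → MultiGraph n → SimpleAdj k → Set
UnderlyingIso {n} {k} G H =
  Σ (Fin n → Fin k) λ f →
    Bijective _≡_ _≡_ f ×
    (∀ u v → (0 < mult G u v) ⇔ T (H (f u) (f v)))

-- Call a list F of vertex pairs transversal if every vertex triple a < b < c
-- contains exactly one pair of F.  Summing the decomposition equations
-- Σ_{t ∋ e} w(t) = 1 over all parallel edges e lying on pairs of F counts each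
-- triangle t exactly once (t has one edge on a pair of F), so the number of
-- edges on F equals the total weight W = Σ_t w(t), independently of F.  On
-- three vertices the singletons {01}, {02}, {12} are transversal, on four
-- vertices the perfect matchings {01,23}, {02,13}, {03,12} are; in both cases
-- they partition the pairs, so |E(G)| = 3·W.
module Submission where

open import Defs
open import Data.Nat as ℕ using (ℕ; zero; suc; _<_; s≤s)
import Data.Nat.Properties as ℕP
open import Data.Nat.Divisibility using (_∣_; divides)
open import Data.Nat.Tactic.RingSolver using (solve-∀)
open import Data.Fin using (Fin; zero; suc; toℕ; #_)
open import Data.Fin.Properties using (toℕ<n; all?) renaming (_≟_ to _≟ᶠ_)
open import Data.Fin.Permutation using (↔⇒≡)
open import Data.Bool using (Bool; true; false; if_then_else_; _∧_; _∨_; T)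
open import Data.Bool.Properties using (∨-identityʳ; ∧-assoc; T-∧)
open import Data.List using (List; []; _∷_)
open import Data.Rational as ℚ using (ℚ; 0ℚ; 1ℚ)
import Data.Rational.Properties as ℚP
open import Algebra.Bundles using (CommutativeMonoid)
open import Algebra.Properties.CommutativeSemigroup
  (CommutativeMonoid.commutativeSemigroup ℚP.+-0-commutativeMonoid) using (interchange)
open import Data.Product using (_×_; _,_; proj₁; proj₂)
open import Data.Sum using (_⊎_; inj₁; inj₂)
open import Data.Unit using (tt)
open import Function.Bundles using (Equivalence; mk⤖)
open import Function.Properties.Bijection using (⤖⇒↔)
open import Relation.Nullary using (Dec; yes; no; ¬_; contradiction)
open import Relation.Nullary.Decidable using (⌊_⌋; toWitness; _→-dec_)
open import Relation.Binary.Definitions using (tri<; tri≈; tri>)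
open import Relation.Binary.PropositionalEquality
  using (_≡_; _≢_; refl; sym; trans; cong; cong₂; subst; module ≡-Reasoning)

[_]_ : Bool → ℚ → ℚ
[ β ] r = if β then r else 0ℚ

sumList : {A : Set} → List A → (A → ℚ) → ℚ
sumList []       f = 0ℚ
sumList (x ∷ xs) f = f x ℚ.+ sumList xs f

sumList-cong : {A : Set} (xs : List A) {f g : A → ℚ} → (∀ x → f x ≡ g x) →
               sumList xs f ≡ sumList xs g
sumList-cong []       f≡g = refl
sumList-cong (x ∷ xs) f≡g = cong₂ ℚ._+_ (f≡g x) (sumList-cong xs f≡g)

sumℚ-cong : ∀ m {f g : Fin m → ℚ} → (∀ i → f i ≡ g i) → sumℚ m f ≡ sumℚ m g
sumℚ-cong zero    f≡g = refl
sumℚ-cong (suc m) f≡g = cong₂ ℚ._+_ (f≡g zero) (sumℚ-cong m (λ i → f≡g (suc i)))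

sumℚ-zero : ∀ m → sumℚ m (λ _ → 0ℚ) ≡ 0ℚ
sumℚ-zero zero    = refl
sumℚ-zero (suc m) = cong (0ℚ ℚ.+_) (sumℚ-zero m)

sumℚ-+ : ∀ m (f g : Fin m → ℚ) →
         sumℚ m (λ i → f i ℚ.+ g i) ≡ sumℚ m f ℚ.+ sumℚ m g
sumℚ-+ zero    f g = refl
sumℚ-+ (suc m) f g =
  trans (cong (f zero ℚ.+ g zero ℚ.+_) (sumℚ-+ m (λ i → f (suc i)) (λ i → g (suc i))))
        (interchange (f zero) (g zero) _ _)

-- The triangle sum of Defs is
-- built from finite sums and conditional terms, hence additive; this is what
-- lets us exchange it with sums over parallel edges and over vertex pairs.
record Additive {X : Set} (F : (X → ℚ) → ℚ) : Set where
  field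
    F-cong : ∀ {φ ψ} → (∀ x → φ x ≡ ψ x) → F φ ≡ F ψ
    F-zero : F (λ _ → 0ℚ) ≡ 0ℚ
    F-+    : ∀ φ ψ → F (λ x → φ x ℚ.+ ψ x) ≡ F φ ℚ.+ F ψ

  F-sumℚ : ∀ m (φ : Fin m → X → ℚ) →
           F (λ x → sumℚ m (λ i → φ i x)) ≡ sumℚ m (λ i → F (φ i))
  F-sumℚ zero    φ = F-zero
  F-sumℚ (suc m) φ =
    trans (F-+ (φ zero) _) (cong (F (φ zero) ℚ.+_) (F-sumℚ m (λ i → φ (suc i))))

  F-sumList : {A : Set} (xs : List A) (φ : A → X → ℚ) →
              F (λ x → sumList xs (λ a → φ a x)) ≡ sumList xs (λ a → F (φ a))
  F-sumList []       φ = F-zero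
  F-sumList (a ∷ xs) φ = trans (F-+ (φ a) _) (cong (F (φ a) ℚ.+_) (F-sumList xs φ))

evaluation-additive : {X : Set} (x : X) → Additive (λ (φ : X → ℚ) → φ x)
evaluation-additive x = record { F-cong = λ eq → eq x ; F-zero = refl ; F-+ = λ _ _ → refl }

sumℚ-additive : {X : Set} (m : ℕ) {F : Fin m → (X → ℚ) → ℚ} →
                (∀ i → Additive (F i)) → Additive (λ φ → sumℚ m (λ i → F i φ))
sumℚ-additive m add = record
  { F-cong = λ eq → sumℚ-cong m (λ i → Additive.F-cong (add i) eq)
  ; F-zero = trans (sumℚ-cong m (λ i → Additive.F-zero (add i))) (sumℚ-zero m)
  ; F-+    = λ φ ψ → trans (sumℚ-cong m (λ i → Additive.F-+ (add i) φ ψ)) (sumℚ-+ m _ _)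
  }

sumIf-additive : {X : Set} {P : Set} (d : Dec P) {F : P → (X → ℚ) → ℚ} →
                 (∀ p → Additive (F p)) → Additive (λ φ → sumIf d (λ p → F p φ))
sumIf-additive (yes p) add = add p
sumIf-additive (no _)  add = record
  { F-cong = λ _ → refl ; F-zero = refl ; F-+ = λ _ _ → sym (ℚP.+-identityˡ 0ℚ) }

sumTriangles-additive : ∀ {n} (G : MultiGraph n) → Additive (sumTriangles G)
sumTriangles-additive {n} G =
  sumℚ-additive n λ a → sumℚ-additive n λ b → sumℚ-additive n λ c →
  sumIf-additive (toℕ a ℕ.<? toℕ b) λ p → sumIf-additive (toℕ b ℕ.<? toℕ c) λ q →
  sumℚ-additive (mult G a b) λ i → sumℚ-additive (mult G b c) λ j →
  sumℚ-additive (mult G a c) λ k → evaluation-additive (tri a b c p q i j k)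

-- The embedding ι : ℕ → ℚ, m ↦ 1 + ⋯ + 1, counting parallel edges in ℚ.
-- It is additive and strictly increasing, hence injective: edge counts with
-- equal total weight are equal.
ι : ℕ → ℚ
ι m = sumℚ m (λ _ → 1ℚ)

ι-+ : ∀ a b → ι (a ℕ.+ b) ≡ ι a ℚ.+ ι b
ι-+ zero    b = sym (ℚP.+-identityˡ (ι b))
ι-+ (suc a) b = trans (cong (1ℚ ℚ.+_) (ι-+ a b)) (sym (ℚP.+-assoc 1ℚ (ι a) (ι b)))

ι-<-suc : ∀ m → ι m ℚ.< ι (suc m)
ι-<-suc m = subst (ℚ._< ι (suc m)) (ℚP.+-identityˡ (ι m))
                  (ℚP.+-monoˡ-< (ι m) (ℚP.positive⁻¹ 1ℚ))

ι-strictMono : ∀ {a b} → a < b → ι a ℚ.< ι b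
ι-strictMono {a} {suc b} (s≤s a≤b) with ℕP.m≤n⇒m<n∨m≡n a≤b
... | inj₁ a<b  = ℚP.<-trans (ι-strictMono a<b) (ι-<-suc b)
... | inj₂ refl = ι-<-suc a

ι-injective : ∀ {a b} → ι a ≡ ι b → a ≡ b
ι-injective {a} {b} ιa≡ιb with ℕP.<-cmp a b
... | tri< a<b _ _ = contradiction ιa≡ιb (λ eq → ℚP.<-irrefl eq (ι-strictMono a<b))
... | tri≈ _ a≡b _ = a≡b
... | tri> _ _ b<a = contradiction (sym ιa≡ιb) (λ eq → ℚP.<-irrefl eq (ι-strictMono b<a))

hits : ∀ {m} → Fin m → ℕ → Bool
hits x ℓ = ⌊ toℕ x ℕ.≟ ℓ ⌋

hits-suc : ∀ {m} (x : Fin m) ℓ → hits (suc x) (suc ℓ) ≡ hits x ℓ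
hits-suc x ℓ with toℕ x ℕ.≟ ℓ | suc (toℕ x) ℕ.≟ suc ℓ
... | yes _   | yes _     = refl
... | no _    | no _      = refl
... | yes x≡ℓ | no sx≢sℓ  = contradiction (cong suc x≡ℓ) sx≢sℓ
... | no x≢ℓ  | yes sx≡sℓ = contradiction (ℕP.suc-injective sx≡sℓ) x≢ℓ

sum-hits : ∀ m ℓ r → ℓ < m → sumℚ m (λ x → [ hits x ℓ ] r) ≡ r
sum-hits (suc m) zero    r _ =
  trans (cong (r ℚ.+_) (sumℚ-zero m)) (ℚP.+-identityʳ r)
sum-hits (suc m) (suc ℓ) r (s≤s ℓ<m) =
  trans (ℚP.+-identityˡ _)
        (trans (sumℚ-cong m (λ x → cong ([_] r) (hits-suc x ℓ))) (sum-hits m ℓ r ℓ<m))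

AtMostOne : Bool → Bool → Bool → Set
AtMostOne P₁ P₂ P₃ = ¬ T (P₁ ∧ P₂) × ¬ T (P₂ ∧ P₃) × ¬ T (P₁ ∧ P₃)

sum-select : ∀ m r (P₁ P₂ P₃ : Bool) (ℓ₁ ℓ₂ ℓ₃ : ℕ) → AtMostOne P₁ P₂ P₃ →
             (T P₁ → ℓ₁ < m) → (T P₂ → ℓ₂ < m) → (T P₃ → ℓ₃ < m) →
             sumℚ m (λ x → [ (P₁ ∧ hits x ℓ₁) ∨ (P₂ ∧ hits x ℓ₂) ∨ (P₃ ∧ hits x ℓ₃) ] r)
               ≡ [ P₁ ∨ P₂ ∨ P₃ ] r
sum-select m r true  true  _     _  _  _  (¬P₁P₂ , _ , _) _ _ _ = contradiction tt ¬P₁P₂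
sum-select m r false true  true  _  _  _  (_ , ¬P₂P₃ , _) _ _ _ = contradiction tt ¬P₂P₃
sum-select m r true  false true  _  _  _  (_ , _ , ¬P₁P₃) _ _ _ = contradiction tt ¬P₁P₃
sum-select m r true  false false ℓ₁ _  _  _ ℓ₁<m _ _ =
  trans (sumℚ-cong m (λ x → cong ([_] r) (∨-identityʳ (hits x ℓ₁)))) (sum-hits m ℓ₁ r (ℓ₁<m tt))
sum-select m r false true  false _  ℓ₂ _  _ _ ℓ₂<m _ =
  trans (sumℚ-cong m (λ x → cong ([_] r) (∨-identityʳ (hits x ℓ₂)))) (sum-hits m ℓ₂ r (ℓ₂<m tt))
sum-select m r false false true  _  _  ℓ₃ _ _ _ ℓ₃<m = sum-hits m ℓ₃ r (ℓ₃<m tt)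
sum-select m r false false false _  _  _  _ _ _ _ = sumℚ-zero m

record VertexPair (n : ℕ) : Set where
  constructor pair
  field
    pu pv : Fin n
    pu<pv : toℕ pu < toℕ pv
open VertexPair

⟪_,_⟫ : ∀ {n} (u v : Fin n) → {T (u <ᵛ v)} → VertexPair n
⟪ u , v ⟫ {u<v} = pair u v (ℕP.<ᵇ⇒< (toℕ u) (toℕ v) u<v)

multOn : ∀ {n} → MultiGraph n → VertexPair n → ℕ
multOn G π = mult G (pu π) (pv π)

-- The pair π is one of the pairs ab, bc, ac of the triple a < b < c
-- (listed in the same order as the three edges in `contains`).
covers : ∀ {n} → Fin n → Fin n → Fin n → VertexPair n → Bool
covers a b c (pair u v _) = (u ==ᵛ a ∧ v ==ᵛ b) ∨ (u ==ᵛ b ∧ v ==ᵛ c) ∨ (u ==ᵛ a ∧ v ==ᵛ c)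

same-pair : ∀ {n} {u v x y : Fin n} → T (u ==ᵛ x ∧ v ==ᵛ y) → u ≡ x × v ≡ y
same-pair {u = u} {v} {x} {y} h with Equivalence.to (T-∧ {u ==ᵛ x} {v ==ᵛ y}) h
... | u≡x , v≡y = toWitness {a? = u ≟ᶠ x} u≡x , toWitness {a? = v ≟ᶠ y} v≡y

same-pairs : ∀ {n} {u v x y x′ y′ : Fin n} →
             T ((u ==ᵛ x ∧ v ==ᵛ y) ∧ (u ==ᵛ x′ ∧ v ==ᵛ y′)) → x ≡ x′ × y ≡ y′
same-pairs {u = u} {v} {x} {y} {x′} {y′} h
  with Equivalence.to (T-∧ {u ==ᵛ x ∧ v ==ᵛ y} {u ==ᵛ x′ ∧ v ==ᵛ y′}) h
... | h₁ , h₂ with same-pair {u = u} {v} {x} {y} h₁ | same-pair {u = u} {v} {x′} {y′} h₂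
...   | refl , refl | refl , refl = refl , refl

covers-atMostOne : ∀ {n} {a b c : Fin n} → toℕ a < toℕ b → toℕ b < toℕ c → (u v : Fin n) →
                   AtMostOne (u ==ᵛ a ∧ v ==ᵛ b) (u ==ᵛ b ∧ v ==ᵛ c) (u ==ᵛ a ∧ v ==ᵛ c)
covers-atMostOne {a = a} {b} {c} a<b b<c u v =
    (λ h → a≢b (proj₁ (same-pairs {u = u} {v} {a} {b} {b} {c} h)))
  , (λ h → a≢b (sym (proj₁ (same-pairs {u = u} {v} {b} {c} {a} {c} h))))
  , (λ h → b≢c (proj₂ (same-pairs {u = u} {v} {a} {b} {a} {c} h)))
  where
  a≢b : a ≢ b
  a≢b eq = ℕP.<⇒≢ a<b (cong toℕ eq)
  b≢c : b ≢ c
  b≢c eq = ℕP.<⇒≢ b<c (cong toℕ eq)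

regroup : ∀ α β γ δ ε ζ h₁ h₂ h₃ →
          (α ∧ β ∧ h₁) ∨ (γ ∧ δ ∧ h₂) ∨ (ε ∧ ζ ∧ h₃)
            ≡ ((α ∧ β) ∧ h₁) ∨ ((γ ∧ δ) ∧ h₂) ∨ ((ε ∧ ζ) ∧ h₃)
regroup α β γ δ ε ζ h₁ h₂ h₃ =
  cong₂ _∨_ (sym (∧-assoc α β h₁)) (cong₂ _∨_ (sym (∧-assoc γ δ h₂)) (sym (∧-assoc ε ζ h₃)))

edgesOfTriangleOn : ∀ {n} {G : MultiGraph n} (t : Triangle G) (π : VertexPair n) (r : ℚ) →
  sumℚ (multOn G π) (λ x → [ contains t (edge (pu π) (pv π) (pu<pv π) x) ] r)
    ≡ [ covers (Triangle.ta t) (Triangle.tb t) (Triangle.tc t) π ] r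
edgesOfTriangleOn {G = G} (tri a b c a<b b<c i j k) (pair u v u<v) r =
  trans (sumℚ-cong (mult G u v) λ x → cong ([_] r)
           (regroup (u ==ᵛ a) (v ==ᵛ b) (u ==ᵛ b) (v ==ᵛ c) (u ==ᵛ a) (v ==ᵛ c)
                    (hits x (toℕ i)) (hits x (toℕ j)) (hits x (toℕ k))))
        (sum-select (mult G u v) r _ _ _ (toℕ i) (toℕ j) (toℕ k)
                    (covers-atMostOne a<b b<c u v) inRange₁ inRange₂ inRange₃)
  where
  inRange₁ : T (u ==ᵛ a ∧ v ==ᵛ b) → toℕ i < mult G u v
  inRange₁ h with same-pair {u = u} {v} {a} {b} h
  ... | refl , refl = toℕ<n i
  inRange₂ : T (u ==ᵛ b ∧ v ==ᵛ c) → toℕ j < mult G u v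
  inRange₂ h with same-pair {u = u} {v} {b} {c} h
  ... | refl , refl = toℕ<n j
  inRange₃ : T (u ==ᵛ a ∧ v ==ᵛ c) → toℕ k < mult G u v
  inRange₃ h with same-pair {u = u} {v} {a} {c} h
  ... | refl , refl = toℕ<n k

countTrue : {A : Set} → (A → Bool) → List A → ℕ
countTrue β []       = 0
countTrue β (x ∷ xs) = if β x then suc (countTrue β xs) else countTrue β xs

sumList-none : {A : Set} (β : A → Bool) (r : ℚ) (xs : List A) →
               countTrue β xs ≡ 0 → sumList xs (λ x → [ β x ] r) ≡ 0ℚ
sumList-none β r []       _ = refl
sumList-none β r (x ∷ xs) none with β x
... | false = trans (ℚP.+-identityˡ _) (sumList-none β r xs none)

sumList-once : {A : Set} (β : A → Bool) (r : ℚ) (xs : List A) →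
               countTrue β xs ≡ 1 → sumList xs (λ x → [ β x ] r) ≡ r
sumList-once β r (x ∷ xs) once with β x
... | true  = trans (cong (r ℚ.+_) (sumList-none β r xs (ℕP.suc-injective once)))
                    (ℚP.+-identityʳ r)
... | false = trans (ℚP.+-identityˡ _) (sumList-once β r xs once)

Transversal : ∀ {n} → List (VertexPair n) → Set
Transversal {n} F = (a b c : Fin n) → toℕ a < toℕ b → toℕ b < toℕ c →
                    countTrue (covers a b c) F ≡ 1

-- Being transversal is decidable (by inspecting all triples), which is how the
-- concrete families below are verified.
transversal? : ∀ {n} (F : List (VertexPair n)) → Dec (Transversal F)
transversal? F = all? λ a → all? λ b → all? λ c →
  (toℕ a ℕ.<? toℕ b) →-dec (toℕ b ℕ.<? toℕ c) →-dec (countTrue (covers a b c) F ℕ.≟ 1)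

edgesOn : ∀ {n} → MultiGraph n → List (VertexPair n) → ℕ
edgesOn G []      = 0
edgesOn G (π ∷ F) = multOn G π ℕ.+ edgesOn G F

ι-edgesOn : ∀ {n} (G : MultiGraph n) F → ι (edgesOn G F) ≡ sumList F (λ π → ι (multOn G π))
ι-edgesOn G []      = refl
ι-edgesOn G (π ∷ F) =
  trans (ι-+ (multOn G π) (edgesOn G F)) (cong (ι (multOn G π) ℚ.+_) (ι-edgesOn G F))

module CountingEdges {n} (G : MultiGraph n) (w : Triangle G → ℚ)
  (decomposes : ∀ (e : Edge G) → sumTriangles G (λ t → [ contains t e ] w t) ≡ 1ℚ) where

  open Additive (sumTriangles-additive G)

  through : VertexPair n → Triangle G → ℚ
  through π t = [ covers (Triangle.ta t) (Triangle.tb t) (Triangle.tc t) π ] w t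

  edgesOnPair : ∀ π → ι (multOn G π) ≡ sumTriangles G (through π)
  edgesOnPair π@(pair u v u<v) = begin
    ι (mult G u v)
      ≡⟨ sumℚ-cong (mult G u v) (λ x → sym (decomposes (edge u v u<v x))) ⟩
    sumℚ (mult G u v) (λ x → sumTriangles G (λ t → [ contains t (edge u v u<v x) ] w t))
      ≡⟨ sym (F-sumℚ (mult G u v) (λ x t → [ contains t (edge u v u<v x) ] w t)) ⟩
    sumTriangles G (λ t → sumℚ (mult G u v) (λ x → [ contains t (edge u v u<v x) ] w t))
      ≡⟨ F-cong (λ t → edgesOfTriangleOn t π (w t)) ⟩
    sumTriangles G (through π) ∎
    where open ≡-Reasoning

  -- Summing over a transversal family counts every triangle exactly once.
  edgesOnTransversal : ∀ F → Transversal F → ι (edgesOn G F) ≡ sumTriangles G w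
  edgesOnTransversal F transversal = begin
    ι (edgesOn G F)                                        ≡⟨ ι-edgesOn G F ⟩
    sumList F (λ π → ι (multOn G π))                       ≡⟨ sumList-cong F edgesOnPair ⟩
    sumList F (λ π → sumTriangles G (through π))           ≡⟨ sym (F-sumList F through) ⟩
    sumTriangles G (λ t → sumList F (λ π → through π t))   ≡⟨ F-cong onceEach ⟩
    sumTriangles G w ∎
    where
    open ≡-Reasoning
    onceEach : ∀ t → sumList F (λ π → through π t) ≡ w t
    onceEach (tri a b c a<b b<c _ _ _) =
      sumList-once (covers a b c) _ F (transversal a b c a<b b<c)

-- If the pairs of G split into three transversal families, the three families
-- carry equally many edges, so the number of edges is a multiple of 3.
threeTransversals : ∀ {n} (G : MultiGraph n) → RationallyK3Decomposable G →
  (F₁ F₂ F₃ : List (VertexPair n)) → Transversal F₁ → Transversal F₂ → Transversal F₃ →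
  numEdges G ≡ edgesOn G F₁ ℕ.+ edgesOn G F₂ ℕ.+ edgesOn G F₃ → 3 ∣ numEdges G
threeTransversals G (w , _ , decomposes) F₁ F₂ F₃ transversal₁ transversal₂ transversal₃ split =
  divides e₁ (begin
    numEdges G                 ≡⟨ split ⟩
    e₁ ℕ.+ e₂ ℕ.+ e₃           ≡⟨ cong₂ (λ x y → e₁ ℕ.+ x ℕ.+ y) (sameCount F₂ transversal₂)
                                                                 (sameCount F₃ transversal₃) ⟩
    e₁ ℕ.+ e₁ ℕ.+ e₁           ≡⟨ thrice e₁ ⟩
    e₁ ℕ.* 3                   ∎)
  where
  open ≡-Reasoning
  open CountingEdges G w decomposes
  e₁ e₂ e₃ : ℕ
  e₁ = edgesOn G F₁
  e₂ = edgesOn G F₂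
  e₃ = edgesOn G F₃
  thrice : ∀ x → x ℕ.+ x ℕ.+ x ≡ x ℕ.* 3
  thrice = solve-∀
  sameCount : ∀ F → Transversal F → edgesOn G F ≡ e₁
  sameCount F transversal =
    ι-injective (trans (edgesOnTransversal F transversal) (sym (edgesOnTransversal F₁ transversal₁)))

-- On three vertices each single pair meets the unique triple.
divisible₃ : (G : MultiGraph 3) → RationallyK3Decomposable G → 3 ∣ numEdges G
divisible₃ G decomposition =
  threeTransversals G decomposition F₀₁ F₀₂ F₁₂
    (toWitness {a? = transversal? F₀₁} tt) (toWitness {a? = transversal? F₀₂} tt)
    (toWitness {a? = transversal? F₁₂} tt)
    (edgeCount (mult G (# 0) (# 1)) (mult G (# 0) (# 2)) (mult G (# 1) (# 2)))
  where
  F₀₁ F₀₂ F₁₂ : List (VertexPair 3)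
  F₀₁ = ⟪ # 0 , # 1 ⟫ ∷ []
  F₀₂ = ⟪ # 0 , # 2 ⟫ ∷ []
  F₁₂ = ⟪ # 1 , # 2 ⟫ ∷ []
  edgeCount : ∀ x y z → x ℕ.+ (y ℕ.+ 0) ℕ.+ (z ℕ.+ 0 ℕ.+ 0) ≡ (x ℕ.+ 0) ℕ.+ (y ℕ.+ 0) ℕ.+ (z ℕ.+ 0)
  edgeCount = solve-∀

-- On four vertices the three perfect matchings are transversal: a triple
-- misses one vertex d; of the two pairs of a matching, the one containing d
-- is not inside the triple and the other one is.
divisible₄ : (G : MultiGraph 4) → RationallyK3Decomposable G → 3 ∣ numEdges G
divisible₄ G decomposition =
  threeTransversals G decomposition M₁ M₂ M₃
    (toWitness {a? = transversal? M₁} tt) (toWitness {a? = transversal? M₂} tt)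
    (toWitness {a? = transversal? M₃} tt)
    (edgeCount (m (# 0) (# 1)) (m (# 0) (# 2)) (m (# 0) (# 3))
               (m (# 1) (# 2)) (m (# 1) (# 3)) (m (# 2) (# 3)))
  where
  m : Fin 4 → Fin 4 → ℕ
  m = mult G
  M₁ M₂ M₃ : List (VertexPair 4)
  M₁ = ⟪ # 0 , # 1 ⟫ ∷ ⟪ # 2 , # 3 ⟫ ∷ []
  M₂ = ⟪ # 0 , # 2 ⟫ ∷ ⟪ # 1 , # 3 ⟫ ∷ []
  M₃ = ⟪ # 0 , # 3 ⟫ ∷ ⟪ # 1 , # 2 ⟫ ∷ []
  edgeCount : ∀ m₀₁ m₀₂ m₀₃ m₁₂ m₁₃ m₂₃ →
    m₀₁ ℕ.+ (m₀₂ ℕ.+ (m₀₃ ℕ.+ 0)) ℕ.+ (m₁₂ ℕ.+ (m₁₃ ℕ.+ 0) ℕ.+ (m₂₃ ℕ.+ 0 ℕ.+ 0))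
      ≡ (m₀₁ ℕ.+ (m₂₃ ℕ.+ 0)) ℕ.+ (m₀₂ ℕ.+ (m₁₃ ℕ.+ 0)) ℕ.+ (m₀₃ ℕ.+ (m₁₂ ℕ.+ 0))
  edgeCount = solve-∀

vertexCount : ∀ {n k} (G : MultiGraph n) (H : SimpleAdj k) → UnderlyingIso G H → n ≡ k
vertexCount G H (_ , bijective , _) = ↔⇒≡ (⤖⇒↔ (mk⤖ bijective))

corollary12 : (n : ℕ) (G : MultiGraph n) →
    RationallyK3Decomposable G →
    (UnderlyingIso G K3 ⊎ UnderlyingIso G K4 ⊎ UnderlyingIso G K4-e) →
    3 ∣ numEdges G
corollary12 n G decomposition (inj₁ isoK3) with vertexCount G K3 isoK3
... | refl = divisible₃ G decomposition
corollary12 n G decomposition (inj₂ (inj₁ isoK4)) with vertexCount G K4 isoK4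
... | refl = divisible₄ G decomposition
corollary12 n G decomposition (inj₂ (inj₂ isoK4-e)) with vertexCount G K4-e isoK4-e
... | refl = divisible₄ G decomposition
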